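{- Let $w\in W^\theta$ and $i\in\{1,\dots,\ell\}$, and write $w^{ -1}\alpha_i=\sigma_i+\kappa_i(w^{ -1})\iota$ with $\sigma_i\in\Delta$ and $\kappa_i(w^{ -1})\in\mathbb Z_{\ge0}$. Then $\kappa_i(w^{ -1})\le\ell(w)+1=\ell(w^{ -1})+1$.
   Context: $\mathfrak g$ is a real split simple finite-dimensional Lie algebra with roots $\Delta$, simple roots $\alpha_1,\dots,\alpha_\ell$, highest root $\alpha_0$. The untwisted affine root system has simple roots $a_i=\alpha_i$ ($i\le\ell$), $a_{\ell+1}=-\alpha_0+\iota$, where $\iota$ is the minimal positive imaginary root; its real roots are $\alpha+n\iota$ ($\alpha\in\Delta$, $n\in\mathbb Z$), positive iff $n>0$ or ($n=0$ and $\alpha>0$). The affine Weyl group $\hat W$ is generated by the simple reflections in $a_1,\dots,a_{\ell+1}$, fixes $\iota$, and $\ell(w)$ is the length. $W\subset\hat W$ is the subgroup generated by the first $\ell$ reflections, and $W^\theta=\{w\in\hat W:w^{ -1}\alpha_i>0\text{ for }i=1,\dots,\ell\}$ (Kostant coset representatives for $W\backslash\hat W$). -}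

module Defs where

open import Data.Nat as ℕ using (ℕ; zero; suc)
open import Data.Integer using (ℤ; +_; -[1+_]; _+_; _*_; -_; _-_; _≤_; _<_; _/_)
open import Data.Integer.Divisibility using (_∣_)
open import Data.Fin using (Fin; zero; suc; _≟_)
open import Data.Maybe using (Maybe; just; nothing)
open import Data.List using (List; []; _∷_; foldr; length; reverse)
open import Data.Product using (Σ; ∃; ∃₂; _×_; _,_; proj₁; proj₂)
open import Data.Sum using (_⊎_)
open import Data.Bool using (Bool; true; false; if_then_else_)
open import Relation.Binary.PropositionalEquality using (_≡_; _≢_)
open import Relation.Nullary.Decidable using (⌊_⌋)

sumFin : (n : ℕ) → (Fin n → ℤ) → ℤ
sumFin zero f = + 0
sumFin (suc n) f = f zero + sumFin n (λ i → f (suc i))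

-- Integer division, with the (never used) convention a / 0 = 0.
divz : ℤ → ℤ → ℤ
divz a (+ zero) = + 0
divz a (+ suc k) = a / (+ suc k)
divz a -[1+ k ] = a / -[1+ k ]

-- Elements of the root lattice, in coordinates w.r.t. the simple roots α_1..α_ℓ.
Lat : ℕ → Set
Lat ℓ = Fin ℓ → ℤ

formB : {ℓ : ℕ} → (Fin ℓ → Fin ℓ → ℤ) → Lat ℓ → Lat ℓ → ℤ
formB {ℓ} B x y = sumFin ℓ (λ i → sumFin ℓ (λ j → x i * B i j * y j))

-- The root datum of a split simple Lie algebra of rank ℓ: an integral Gram
-- matrix B_ij = (α_i , α_j) of the invariant form on the simple roots, such
-- that the Cartan matrix 2 B_ij / B_ii is an indecomposable generalized
-- Cartan matrix of finite type (positive definite symmetrization).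
record CartanDatum (ℓ : ℕ) : Set where
  field
    B : Fin ℓ → Fin ℓ → ℤ
    symmetric : ∀ i j → B i j ≡ B j i
    integral : ∀ i j → B i i ∣ (+ 2) * B i j
    nonpos : ∀ i j → i ≢ j → B i j ≤ + 0
    posdef : ∀ (x : Lat ℓ) → (∃ λ j → x j ≢ + 0) → + 0 < formB B x x
    indecomposable : ∀ (S : Fin ℓ → Bool) → (∃ λ i → S i ≡ true) → (∃ λ j → S j ≡ false)
                     → ∃₂ λ i j → S i ≡ true × S j ≡ false × B i j ≢ + 0

module _ {ℓ : ℕ} (D : CartanDatum ℓ) where
  open CartanDatum D

  ip : Lat ℓ → Lat ℓ → ℤ
  ip = formB B

  e : Fin ℓ → Lat ℓ
  e i j = if ⌊ i ≟ j ⌋ then + 1 else + 0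

  pair : Lat ℓ → Lat ℓ → ℤ
  pair γ β = divz ((+ 2) * ip γ β) (ip β β)

  reflect : Lat ℓ → Lat ℓ → Lat ℓ
  reflect β γ j = γ j - pair γ β * β j

  actFin : List (Fin ℓ) → Lat ℓ → Lat ℓ
  actFin u v = foldr (λ i w → reflect (e i) w) v u

  InΔ : Lat ℓ → Set
  InΔ γ = ∃₂ λ (u : List (Fin ℓ)) (i : Fin ℓ) → ∀ j → actFin u (e i) j ≡ γ j

  IsHighestRoot : Lat ℓ → Set
  IsHighestRoot θ = InΔ θ × (∀ β → InΔ β → ∀ j → β j ≤ θ j)

  -- affine root lattice: (γ , n) stands for γ + n ι
  Aff : Set
  Aff = Lat ℓ × ℤ

  -- reflection in the real affine root β + n ι (ι is in the radical)
  affReflect : Aff → Aff → Aff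
  affReflect (β , n) (γ , m) = (λ j → γ j - pair γ β * β j) , (m - pair γ β * n)

  -- affine simple reflections: just i ↦ s_{a_i} (a_i = α_i), nothing ↦ s_{a_{ℓ+1}}
  -- with a_{ℓ+1} = -θ + ι
  sAff : Lat ℓ → Maybe (Fin ℓ) → Aff → Aff
  sAff θ (just i) = affReflect (e i , + 0)
  sAff θ nothing = affReflect ((λ j → - θ j) , + 1)

  -- words in the affine simple reflections, representing elements of Ŵ
  Word : Set
  Word = List (Maybe (Fin ℓ))

  act : Lat ℓ → Word → Aff → Aff
  act θ u v = foldr (λ i w → sAff θ i w) v u

  -- equality in Ŵ (Ŵ acts faithfully on the affine root lattice)
  EqW : Lat ℓ → Word → Word → Set
  EqW θ u w = ∀ v → (∀ j → proj₁ (act θ u v) j ≡ proj₁ (act θ w v) j)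
                    × proj₂ (act θ u v) ≡ proj₂ (act θ w v)

  -- inverse of the element represented by a word (generators are involutions)
  inv : Word → Word
  inv = reverse

  IsLength : Lat ℓ → Word → ℕ → Set
  IsLength θ w k = (∃ λ u → length u ≡ k × EqW θ u w)
                   × (∀ u → EqW θ u w → k ℕ.≤ length u)

  IsPosAff : Aff → Set
  IsPosAff (γ , n) = (+ 0 < n) ⊎ (n ≡ + 0 × (∀ j → + 0 ≤ γ j))

  InWθ : Lat ℓ → Word → Set
  InWθ θ w = ∀ i → IsPosAff (act θ (inv w) (e i , + 0))

  kappa : Lat ℓ → Word → Fin ℓ → ℤ
  kappa θ w i = proj₂ (act θ (inv w) (e i , + 0))

-- Take a reduced word u for w, so that w⁻¹α_i is obtained from (α_i , 0) by the reflections of the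
-- reversed word, and ℓ(w⁻¹) = ℓ(w) because the generators are involutions.  Along the way the finite
-- part γ keeps its length, and every root is at most as long as the highest root θ (raise it to a
-- dominant conjugate β and expand (θ,θ) − (β,β) = (θ − β, θ + β) ≥ 0).  A simple reflection s_j leaves
-- the ι-coefficient n alone, while the affine one (in −θ + ι) adds ⟨γ , θ^∨⟩, which is at most 1
-- unless γ = θ, when it is 2 and γ becomes −θ.  So n − [γ = −θ] grows by at most one per letter,
-- and from (α_i , 0) we reach n ≤ k + 1.

module Submission where

open import Defs
open import Data.Nat as ℕ using (ℕ; zero; suc)
open import Data.Integer.Base as ℤ using (ℤ; +_; -[1+_]; _+_; _*_; -_; _-_; _≤_; _<_; +≤+; +<+)
import Data.Integer.Properties as ℤ
open import Data.Integer.DivMod using (_/_; _%_)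
import Data.Integer.DivMod as ℤ
import Data.Integer.Divisibility.Signed as ℤ∣
import Data.Nat.Divisibility as ℕ∣
open import Data.Integer.Tactic.RingSolver using (solve-∀)
open import Algebra.Properties.Semiring.Sum ℤ.+-*-semiring
  using (sum; sum-cong-≗; sum-replicate-zero; ∑-comm; ∑-distrib-+; *-distribˡ-sum)
open import Algebra.Properties.AbelianGroup ℤ.+-0-abelianGroup using (inverseˡ-unique)
open import Data.Fin.Base using (Fin; zero; suc)
open import Data.Fin.Properties using (all?; ¬∀⟶∃¬)
import Data.Fin.Properties as Fin
open import Data.Bool.Base using (if_then_else_)
open import Data.List.Base using ([]; _∷_; _++_; length)
import Data.List.Properties as List
open import Data.Maybe.Base using (just; nothing)
open import Data.Product.Base using (∃; _×_; _,_; proj₁; proj₂)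
open import Data.Sum.Base using (inj₁; inj₂)
open import Function.Base using (_∘_)
open import Relation.Binary.PropositionalEquality
open import Relation.Nullary using (¬_; Dec; yes; no; contradiction)
open import Relation.Nullary.Decidable using (⌊_⌋)

-- The simple root e D i is the row δ i; δ exists for every n so that sums over it go by induction.
δ : ∀ {n} → Fin n → Fin n → ℤ
δ i j = if ⌊ i Fin.≟ j ⌋ then + 1 else + 0

δ-diag : ∀ {n} (i : Fin n) → δ i i ≡ + 1
δ-diag i with i Fin.≟ i
... | yes _   = refl
... | no  i≢i = contradiction refl i≢i

δ-suc : ∀ {n} (i j : Fin n) → δ (suc i) (suc j) ≡ δ i j
δ-suc i j with i Fin.≟ j
... | yes _ = refl
... | no  _ = refl

sumFin≡sum : ∀ n (f : Fin n → ℤ) → sumFin n f ≡ sum f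
sumFin≡sum zero    f = refl
sumFin≡sum (suc n) f = cong (λ t → f zero + t) (sumFin≡sum n (f ∘ suc))

sum-linear : ∀ {n} a c (f g : Fin n → ℤ) →
             sum (λ i → a * f i + c * g i) ≡ a * sum f + c * sum g
sum-linear a c f g = begin
  sum (λ i → a * f i + c * g i)      ≡⟨ ∑-distrib-+ (λ i → a * f i) (λ i → c * g i) ⟩
  sum (λ i → a * f i) + sum (λ i → c * g i)
    ≡⟨ sym (cong₂ _+_ (*-distribˡ-sum a f) (*-distribˡ-sum c g)) ⟩
  a * sum f + c * sum g              ∎
  where open ≡-Reasoning

sum-δˡ : ∀ {n} (i : Fin n) (f : Fin n → ℤ) → sum (λ j → δ i j * f j) ≡ f i
sum-δˡ {suc n} zero    f = begin
  + 1 * f zero + sum (λ j → + 0 * f (suc j)) ≡⟨ cong₂ _+_ (ℤ.*-identityˡ (f zero)) (sum-replicate-zero n) ⟩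
  f zero + + 0                               ≡⟨ ℤ.+-identityʳ (f zero) ⟩
  f zero                                     ∎
  where open ≡-Reasoning
sum-δˡ (suc i) f = begin
  sum (λ j → δ (suc i) j * f j)        ≡⟨ ℤ.+-identityˡ _ ⟩
  sum (λ j → δ (suc i) (suc j) * f (suc j))
    ≡⟨ sum-cong-≗ (λ j → cong (_* f (suc j)) (δ-suc i j)) ⟩
  sum (λ j → δ i j * f (suc j))        ≡⟨ sum-δˡ i (f ∘ suc) ⟩
  f (suc i)                            ∎
  where open ≡-Reasoning

sum-δʳ : ∀ {n} (i : Fin n) (f : Fin n → ℤ) → sum (λ j → f j * δ i j) ≡ f i
sum-δʳ i f = trans (sum-cong-≗ (λ j → ℤ.*-comm (f j) (δ i j))) (sum-δˡ i f)

sum-mono-≤ : ∀ {n} {f g : Fin n → ℤ} → (∀ i → f i ≤ g i) → sum f ≤ sum g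
sum-mono-≤ {zero}  _   = ℤ.≤-refl
sum-mono-≤ {suc n} f≤g = ℤ.+-mono-≤ (f≤g zero) (sum-mono-≤ (f≤g ∘ suc))

sum-nonneg : ∀ {n} {f : Fin n → ℤ} → (∀ i → + 0 ≤ f i) → + 0 ≤ sum f
sum-nonneg {n} {f} 0≤f = subst (_≤ sum f) (sum-replicate-zero n) (sum-mono-≤ 0≤f)

sum-∣ : ∀ {n} {d} {f : Fin n → ℤ} → (∀ i → d ℤ∣.∣ f i) → d ℤ∣.∣ sum f
sum-∣ {zero}  _    = ℤ∣.divides (+ 0) refl
sum-∣ {suc n} d∣f = ℤ∣.∣m∣n⇒∣m+n (d∣f zero) (sum-∣ (d∣f ∘ suc))

*-nonneg : ∀ {i j} → + 0 ≤ i → + 0 ≤ j → + 0 ≤ i * j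
*-nonneg {+ m} {+ n} _ _ = subst (+ 0 ≤_) (ℤ.pos-* m n) (+≤+ ℕ.z≤n)

divz-exact : ∀ a b → + 0 < b → b ℤ∣.∣ a → divz a b * b ≡ a
divz-exact a (+ zero) (+<+ ()) _
divz-exact a b@(+ suc _) _ b∣a = begin
  a / b * b              ≡⟨ ℤ.+-identityˡ _ ⟨
  + 0 + a / b * b        ≡⟨ cong (λ r → + r + a / b * b) remainder-zero ⟨
  + (a % b) + a / b * b  ≡⟨ ℤ.a≡a%n+[a/n]*n a b ⟨
  a                      ∎
  where
  open ≡-Reasoning
  b∣remainder : b ℤ∣.∣ + (a % b)
  b∣remainder = ℤ∣.∣m+n∣n⇒∣m (subst (b ℤ∣.∣_) (ℤ.a≡a%n+[a/n]*n a b) b∣a)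
                              (ℤ∣.∣n⇒∣m*n (a / b) ℤ∣.∣-refl)
  remainder-zero : a % b ≡ 0
  remainder-zero with a % b | ℤ.n%d<d a b | b∣remainder
  ... | zero  | _   | _   = refl
  ... | suc _ | r<b | b∣r = contradiction (ℤ∣.∣⇒∣ᵤ b∣r) (ℕ∣.>⇒∤ r<b)

i<0⇒+1≤-i : ∀ {q} → q < + 0 → + 1 ≤ - q
i<0⇒+1≤-i {+ _}       (+<+ ())
i<0⇒+1≤-i { -[1+ _ ]} _ = +≤+ (ℕ.s≤s ℕ.z≤n)

module _ {ℓ : ℕ} (D : CartanDatum ℓ) where
  open CartanDatum D

  ⟨_,_⟩ : Lat ℓ → Lat ℓ → ℤ
  ⟨_,_⟩ = ip D

  α : Fin ℓ → Lat ℓ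
  α = e D

  ip-double-sum : ∀ x y → ⟨ x , y ⟩ ≡ sum (λ i → sum (λ j → x i * B i j * y j))
  ip-double-sum x y = trans (sumFin≡sum ℓ (λ i → sumFin ℓ (term i)))
                            (sum-cong-≗ (λ i → sumFin≡sum ℓ (term i)))
    where
    term : Fin ℓ → Fin ℓ → ℤ
    term i j = x i * B i j * y j

  ip-sym : ∀ x y → ⟨ x , y ⟩ ≡ ⟨ y , x ⟩
  ip-sym x y = begin
    ⟨ x , y ⟩                                      ≡⟨ ip-double-sum x y ⟩
    sum (λ i → sum (λ j → x i * B i j * y j))      ≡⟨ ∑-comm (λ i j → x i * B i j * y j) ⟩
    sum (λ j → sum (λ i → x i * B i j * y j))      ≡⟨ sum-cong-≗ (λ j → sum-cong-≗ (λ i → swap j i)) ⟩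
    sum (λ j → sum (λ i → y j * B j i * x i))      ≡⟨ ip-double-sum y x ⟨
    ⟨ y , x ⟩                                      ∎
    where
    open ≡-Reasoning
    swap : ∀ j i → x i * B i j * y j ≡ y j * B j i * x i
    swap j i = trans (cong (λ b → x i * b * y j) (symmetric i j)) (reverse³ (x i) (B j i) (y j))
      where reverse³ : ∀ a b c → a * b * c ≡ c * b * a
            reverse³ = solve-∀

  ip-rows : ∀ x y → ⟨ x , y ⟩ ≡ sum (λ i → x i * sum (λ j → B i j * y j))
  ip-rows x y = trans (ip-double-sum x y) (sum-cong-≗ λ i →
    trans (sum-cong-≗ (λ j → ℤ.*-assoc (x i) (B i j) (y j))) (sym (*-distribˡ-sum (x i) (λ j → B i j * y j))))

  ip-αˡ : ∀ i y → ⟨ α i , y ⟩ ≡ sum (λ j → B i j * y j)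
  ip-αˡ i y = trans (ip-rows (α i) y) (sum-δˡ i _)

  ip-α-α : ∀ i j → ⟨ α i , α j ⟩ ≡ B i j
  ip-α-α i j = trans (ip-αˡ i (α j)) (sum-δʳ j (B i))

  ip-expandˡ : ∀ x y → ⟨ x , y ⟩ ≡ sum (λ i → x i * ⟨ α i , y ⟩)
  ip-expandˡ x y = trans (ip-rows x y) (sum-cong-≗ (λ i → cong (x i *_) (sym (ip-αˡ i y))))

  ip-congˡ : ∀ {x x'} y → x ≗ x' → ⟨ x , y ⟩ ≡ ⟨ x' , y ⟩
  ip-congˡ {x} {x'} y x≗x' = begin
    ⟨ x , y ⟩                          ≡⟨ ip-expandˡ x y ⟩
    sum (λ i → x i * ⟨ α i , y ⟩)     ≡⟨ sum-cong-≗ (λ i → cong (_* ⟨ α i , y ⟩) (x≗x' i)) ⟩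
    sum (λ i → x' i * ⟨ α i , y ⟩)    ≡⟨ ip-expandˡ x' y ⟨
    ⟨ x' , y ⟩                         ∎
    where open ≡-Reasoning

  ip-congʳ : ∀ x {y y'} → y ≗ y' → ⟨ x , y ⟩ ≡ ⟨ x , y' ⟩
  ip-congʳ x {y} {y'} y≗y' = trans (ip-sym x y) (trans (ip-congˡ x y≗y') (ip-sym y' x))

  ip-linearˡ : ∀ a c x y {z} w → (∀ j → z j ≡ a * x j + c * y j) →
               ⟨ z , w ⟩ ≡ a * ⟨ x , w ⟩ + c * ⟨ y , w ⟩
  ip-linearˡ a c x y {z} w z≗ax+cy = begin
    ⟨ z , w ⟩                                                ≡⟨ ip-expandˡ z w ⟩
    sum (λ i → z i * ⟨ α i , w ⟩)                            ≡⟨ sum-cong-≗ distrib ⟩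
    sum (λ i → a * (x i * ⟨ α i , w ⟩) + c * (y i * ⟨ α i , w ⟩))
      ≡⟨ sum-linear a c (λ i → x i * ⟨ α i , w ⟩) (λ i → y i * ⟨ α i , w ⟩) ⟩
    a * sum (λ i → x i * ⟨ α i , w ⟩) + c * sum (λ i → y i * ⟨ α i , w ⟩)
      ≡⟨ cong₂ (λ s t → a * s + c * t) (ip-expandˡ x w) (ip-expandˡ y w) ⟨
    a * ⟨ x , w ⟩ + c * ⟨ y , w ⟩                            ∎
    where
    open ≡-Reasoning
    distrib : ∀ i → z i * ⟨ α i , w ⟩ ≡ a * (x i * ⟨ α i , w ⟩) + c * (y i * ⟨ α i , w ⟩)
    distrib i = trans (cong (_* ⟨ α i , w ⟩) (z≗ax+cy i)) (distribute a c (x i) (y i) ⟨ α i , w ⟩)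
      where distribute : ∀ a c u v t → (a * u + c * v) * t ≡ a * (u * t) + c * (v * t)
            distribute = solve-∀

  ip-linearʳ : ∀ a c x y {z} w → (∀ j → z j ≡ a * x j + c * y j) →
               ⟨ w , z ⟩ ≡ a * ⟨ w , x ⟩ + c * ⟨ w , y ⟩
  ip-linearʳ a c x y {z} w z≗ax+cy = begin
    ⟨ w , z ⟩                         ≡⟨ ip-sym w z ⟩
    ⟨ z , w ⟩                         ≡⟨ ip-linearˡ a c x y w z≗ax+cy ⟩
    a * ⟨ x , w ⟩ + c * ⟨ y , w ⟩     ≡⟨ cong₂ (λ s t → a * s + c * t) (ip-sym x w) (ip-sym y w) ⟩
    a * ⟨ w , x ⟩ + c * ⟨ w , y ⟩     ∎
    where open ≡-Reasoning

  _+ᵛ_ _-ᵛ_ : Lat ℓ → Lat ℓ → Lat ℓ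
  (x +ᵛ y) j = x j + y j
  (x -ᵛ y) j = x j - y j

  ip-+ˡ : ∀ x y z → ⟨ x +ᵛ y , z ⟩ ≡ ⟨ x , z ⟩ + ⟨ y , z ⟩
  ip-+ˡ x y z = trans (ip-linearˡ (+ 1) (+ 1) x y z (λ j → unit-coefficients (x j) (y j)))
                      (sym (unit-coefficients (⟨ x , z ⟩) (⟨ y , z ⟩)))
    where unit-coefficients : ∀ a b → a + b ≡ + 1 * a + + 1 * b
          unit-coefficients = solve-∀

  ip-+ʳ : ∀ z x y → ⟨ z , x +ᵛ y ⟩ ≡ ⟨ z , x ⟩ + ⟨ z , y ⟩
  ip-+ʳ z x y = trans (ip-sym z (x +ᵛ y)) (trans (ip-+ˡ x y z) (cong₂ _+_ (ip-sym x z) (ip-sym y z)))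

  ip--ˡ : ∀ x y z → ⟨ x -ᵛ y , z ⟩ ≡ ⟨ x , z ⟩ - ⟨ y , z ⟩
  ip--ˡ x y z = trans (ip-linearˡ (+ 1) (- + 1) x y z (λ j → unit-coefficients (x j) (y j)))
                      (sym (unit-coefficients (⟨ x , z ⟩) (⟨ y , z ⟩)))
    where unit-coefficients : ∀ a b → a - b ≡ + 1 * a + - + 1 * b
          unit-coefficients = solve-∀

  ip-+-self : ∀ x y → ⟨ x +ᵛ y , x +ᵛ y ⟩ ≡ ⟨ x , x ⟩ + + 2 * ⟨ x , y ⟩ + ⟨ y , y ⟩
  ip-+-self x y = begin
    ⟨ x +ᵛ y , x +ᵛ y ⟩                                  ≡⟨ ip-+ˡ x y (x +ᵛ y) ⟩
    ⟨ x , x +ᵛ y ⟩ + ⟨ y , x +ᵛ y ⟩                      ≡⟨ cong₂ _+_ (ip-+ʳ x x y) (ip-+ʳ y x y) ⟩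
    (⟨ x , x ⟩ + ⟨ x , y ⟩) + (⟨ y , x ⟩ + ⟨ y , y ⟩)   ≡⟨ cong (λ t → (⟨ x , x ⟩ + ⟨ x , y ⟩) + (t + ⟨ y , y ⟩))
                                                                 (ip-sym y x) ⟩
    (⟨ x , x ⟩ + ⟨ x , y ⟩) + (⟨ x , y ⟩ + ⟨ y , y ⟩)   ≡⟨ collect (⟨ x , x ⟩) (⟨ x , y ⟩) (⟨ y , y ⟩) ⟩
    ⟨ x , x ⟩ + + 2 * ⟨ x , y ⟩ + ⟨ y , y ⟩             ∎
    where
    open ≡-Reasoning
    collect : ∀ a p b → (a + p) + (p + b) ≡ a + + 2 * p + b
    collect = solve-∀

  ip-difference-of-squares : ∀ x y → ⟨ x , x ⟩ - ⟨ y , y ⟩ ≡ ⟨ x -ᵛ y , x +ᵛ y ⟩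
  ip-difference-of-squares x y = sym (begin
    ⟨ x -ᵛ y , x +ᵛ y ⟩                                  ≡⟨ ip--ˡ x y (x +ᵛ y) ⟩
    ⟨ x , x +ᵛ y ⟩ - ⟨ y , x +ᵛ y ⟩                      ≡⟨ cong₂ _-_ (ip-+ʳ x x y) (ip-+ʳ y x y) ⟩
    (⟨ x , x ⟩ + ⟨ x , y ⟩) - (⟨ y , x ⟩ + ⟨ y , y ⟩)   ≡⟨ cong (λ t → (⟨ x , x ⟩ + ⟨ x , y ⟩) - (t + ⟨ y , y ⟩))
                                                                 (ip-sym y x) ⟩
    (⟨ x , x ⟩ + ⟨ x , y ⟩) - (⟨ x , y ⟩ + ⟨ y , y ⟩)   ≡⟨ cancel (⟨ x , x ⟩) (⟨ x , y ⟩) (⟨ y , y ⟩) ⟩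
    ⟨ x , x ⟩ - ⟨ y , y ⟩                                ∎)
    where
    open ≡-Reasoning
    cancel : ∀ a p b → (a + p) - (p + b) ≡ a - b
    cancel = solve-∀

  ip-self-nonpos⇒≗0 : ∀ x → ⟨ x , x ⟩ ≤ + 0 → x ≗ (λ _ → + 0)
  ip-self-nonpos⇒≗0 x x²≤0 with all? (λ j → x j ℤ.≟ + 0)
  ... | yes x≗0 = x≗0
  ... | no  x≉0 = contradiction x²≤0 (ℤ.<⇒≱ (posdef x (¬∀⟶∃¬ ℓ _ (λ j → x j ℤ.≟ + 0) x≉0)))

  ip-α-self-pos : ∀ i → + 0 < ⟨ α i , α i ⟩
  ip-α-self-pos i = posdef (α i) (i , λ δii≡0 → contradiction (trans (sym (δ-diag i)) δii≡0) λ ())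

  Dominant : Lat ℓ → Set
  Dominant y = ∀ i → + 0 ≤ ⟨ α i , y ⟩

  ip-nonneg-dominant : ∀ {x y} → (∀ i → + 0 ≤ x i) → Dominant y → + 0 ≤ ⟨ x , y ⟩
  ip-nonneg-dominant {x} {y} x≥0 y-dom =
    subst (+ 0 ≤_) (sym (ip-expandˡ x y)) (sum-nonneg (λ i → *-nonneg (x≥0 i) (y-dom i)))

  Dominant-+ : ∀ {x y} → Dominant x → Dominant y → Dominant (x +ᵛ y)
  Dominant-+ {x} {y} x-dominant y-dominant i =
    subst (+ 0 ≤_) (sym (ip-+ʳ (α i) x y)) (ℤ.+-mono-≤ (x-dominant i) (y-dominant i))

  neg : Lat ℓ → Lat ℓ
  neg x j = - x j

  ip-negʳ : ∀ x y → ⟨ x , neg y ⟩ ≡ - ⟨ x , y ⟩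
  ip-negʳ x y = trans (ip-linearʳ (- + 1) (+ 0) y y x (λ j → as-combination (y j)))
                      (sym (as-combination ⟨ x , y ⟩))
    where as-combination : ∀ a → - a ≡ - + 1 * a + + 0 * a
          as-combination = solve-∀

  ip-neg-neg : ∀ x → ⟨ neg x , neg x ⟩ ≡ ⟨ x , x ⟩
  ip-neg-neg x = begin
    ⟨ neg x , neg x ⟩    ≡⟨ ip-negʳ (neg x) x ⟩
    - ⟨ neg x , x ⟩      ≡⟨ cong -_ (trans (ip-sym (neg x) x) (ip-negʳ x x)) ⟩
    - - ⟨ x , x ⟩        ≡⟨ ℤ.neg-involutive _ ⟩
    ⟨ x , x ⟩            ∎
    where open ≡-Reasoning

  pair-congˡ : ∀ {x x'} β → x ≗ x' → pair D x β ≡ pair D x' β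
  pair-congˡ β x≗x' = cong (λ t → divz (+ 2 * t) ⟨ β , β ⟩) (ip-congˡ β x≗x')

  _≈ᴬ_ : Aff D → Aff D → Set
  p ≈ᴬ p' = proj₁ p ≗ proj₁ p' × proj₂ p ≡ proj₂ p'

  ≡⇒≈ᴬ : ∀ {p p'} → p ≡ p' → p ≈ᴬ p'
  ≡⇒≈ᴬ refl = (λ _ → refl) , refl

  ≈ᴬ-refl : ∀ {p} → p ≈ᴬ p
  ≈ᴬ-refl = ≡⇒≈ᴬ refl

  ≈ᴬ-sym : ∀ {p p'} → p ≈ᴬ p' → p' ≈ᴬ p
  ≈ᴬ-sym (γ≗γ' , n≡n') = (λ j → sym (γ≗γ' j)) , sym n≡n'

  ≈ᴬ-trans : ∀ {p p' p''} → p ≈ᴬ p' → p' ≈ᴬ p'' → p ≈ᴬ p''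
  ≈ᴬ-trans (γ≗γ' , n≡n') (γ'≗γ'' , n'≡n'') = (λ j → trans (γ≗γ' j) (γ'≗γ'' j)) , trans n≡n' n'≡n''

  affReflect-cong : ∀ b {p p'} → p ≈ᴬ p' → affReflect D b p ≈ᴬ affReflect D b p'
  affReflect-cong (β , m) {γ , _} {γ' , _} (γ≗γ' , n≡n') =
    (λ j → cong₂ (λ a c → a - c * β j) (γ≗γ' j) pair≡) , cong₂ (λ a c → a - c * m) n≡n' pair≡
    where
    pair≡ : pair D γ β ≡ pair D γ' β
    pair≡ = pair-congˡ β γ≗γ'

  reflect-congʳ : ∀ β {x x'} → x ≗ x' → reflect D β x ≗ reflect D β x'
  reflect-congʳ β x≗x' = proj₁ (affReflect-cong (β , + 0) (x≗x' , refl {x = + 0}))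

  record Reflectable (β : Lat ℓ) : Set where
    field
      ip-self-pos : + 0 < ⟨ β , β ⟩
      ip-self-∣   : ∀ x → ⟨ β , β ⟩ ℤ∣.∣ + 2 * ⟨ x , β ⟩

  module Reflection {β : Lat ℓ} (β-reflectable : Reflectable β) where
    open Reflectable β-reflectable

    private
      s : Lat ℓ → Lat ℓ
      s = reflect D β

      q : Lat ℓ → ℤ
      q x = pair D x β

    pair-exact : ∀ x → q x * ⟨ β , β ⟩ ≡ + 2 * ⟨ x , β ⟩
    pair-exact x = divz-exact _ _ ip-self-pos (ip-self-∣ x)

    pair-unique : ∀ x c → c * ⟨ β , β ⟩ ≡ + 2 * ⟨ x , β ⟩ → q x ≡ c
    pair-unique x c c-exact = ℤ.*-cancelʳ-≡ _ _ ⟨ β , β ⟩ {{ℤ.>-nonZero ip-self-pos}}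
                                (trans (pair-exact x) (sym c-exact))

    ip-reflectˡ : ∀ x y → ⟨ s x , y ⟩ ≡ ⟨ x , y ⟩ - q x * ⟨ β , y ⟩
    ip-reflectˡ x y = trans (ip-linearˡ (+ 1) (- q x) x β y (λ j → as-combination (x j) (q x) (β j)))
                            (sym (as-combination ⟨ x , y ⟩ (q x) ⟨ β , y ⟩))
      where as-combination : ∀ a c b → a - c * b ≡ + 1 * a + - c * b
            as-combination = solve-∀

    pair-reflect : ∀ x → q (s x) ≡ - q x
    pair-reflect x = pair-unique (s x) (- q x) (sym (begin
      + 2 * ⟨ s x , β ⟩                            ≡⟨ cong (λ t → + 2 * t) (ip-reflectˡ x β) ⟩
      + 2 * (⟨ x , β ⟩ - q x * ⟨ β , β ⟩)           ≡⟨ expand (⟨ x , β ⟩) (q x) (⟨ β , β ⟩) ⟩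
      + 2 * ⟨ x , β ⟩ - + 2 * (q x * ⟨ β , β ⟩)     ≡⟨ cong (λ t → t - + 2 * (q x * ⟨ β , β ⟩)) (pair-exact x) ⟨
      q x * ⟨ β , β ⟩ - + 2 * (q x * ⟨ β , β ⟩)     ≡⟨ collect (q x) (⟨ β , β ⟩) ⟩
      - q x * ⟨ β , β ⟩                            ∎))
      where
      open ≡-Reasoning
      expand : ∀ p c b → + 2 * (p - c * b) ≡ + 2 * p - + 2 * (c * b)
      expand = solve-∀
      collect : ∀ c b → c * b - + 2 * (c * b) ≡ - c * b
      collect = solve-∀

    affReflect-involutive : ∀ m p → affReflect D (β , m) (affReflect D (β , m) p) ≈ᴬ p
    affReflect-involutive m (γ , n) =
      (λ j → trans (cong (λ c → (γ j - q γ * β j) - c * β j) (pair-reflect γ)) (cancel (γ j) (q γ) (β j))) ,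
      trans (cong (λ c → (n - q γ * m) - c * m) (pair-reflect γ)) (cancel n (q γ) m)
      where cancel : ∀ a c b → (a - c * b) - - c * b ≡ a
            cancel = solve-∀

    reflect-involutive : ∀ x → s (s x) ≗ x
    reflect-involutive x = proj₁ (affReflect-involutive (+ 0) (x , + 0))

    pair-symmetry : ∀ x y → q y * ⟨ x , β ⟩ ≡ q x * ⟨ y , β ⟩
    pair-symmetry x y = ℤ.*-cancelʳ-≡ _ _ ⟨ β , β ⟩ {{ℤ.>-nonZero ip-self-pos}} (begin
      q y * ⟨ x , β ⟩ * ⟨ β , β ⟩      ≡⟨ swap₂₃ (q y) (⟨ x , β ⟩) (⟨ β , β ⟩) ⟩
      q y * ⟨ β , β ⟩ * ⟨ x , β ⟩      ≡⟨ cong (λ t → t * ⟨ x , β ⟩) (pair-exact y) ⟩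
      + 2 * ⟨ y , β ⟩ * ⟨ x , β ⟩      ≡⟨ swap₂₃ (+ 2) (⟨ y , β ⟩) (⟨ x , β ⟩) ⟩
      + 2 * ⟨ x , β ⟩ * ⟨ y , β ⟩      ≡⟨ cong (λ t → t * ⟨ y , β ⟩) (pair-exact x) ⟨
      q x * ⟨ β , β ⟩ * ⟨ y , β ⟩      ≡⟨ swap₂₃ (q x) (⟨ β , β ⟩) (⟨ y , β ⟩) ⟩
      q x * ⟨ y , β ⟩ * ⟨ β , β ⟩      ∎)
      where
      open ≡-Reasoning
      swap₂₃ : ∀ a b c → a * b * c ≡ a * c * b
      swap₂₃ = solve-∀

    ip-reflect-adjoint : ∀ x y → ⟨ x , s y ⟩ ≡ ⟨ s x , y ⟩
    ip-reflect-adjoint x y = begin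
      ⟨ x , s y ⟩                          ≡⟨ ip-sym x (s y) ⟩
      ⟨ s y , x ⟩                          ≡⟨ ip-reflectˡ y x ⟩
      ⟨ y , x ⟩ - q y * ⟨ β , x ⟩          ≡⟨ cong₂ (λ a b → a - q y * b) (ip-sym y x) (ip-sym β x) ⟩
      ⟨ x , y ⟩ - q y * ⟨ x , β ⟩          ≡⟨ cong (λ t → ⟨ x , y ⟩ - t) (pair-symmetry x y) ⟩
      ⟨ x , y ⟩ - q x * ⟨ y , β ⟩          ≡⟨ cong (λ b → ⟨ x , y ⟩ - q x * b) (ip-sym y β) ⟩
      ⟨ x , y ⟩ - q x * ⟨ β , y ⟩          ≡⟨ ip-reflectˡ x y ⟨
      ⟨ s x , y ⟩                          ∎
      where open ≡-Reasoning

    ip-reflect-self : ∀ x → ⟨ s x , s x ⟩ ≡ ⟨ x , x ⟩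
    ip-reflect-self x = trans (ip-reflect-adjoint (s x) x) (ip-congˡ x (reflect-involutive x))

    pair-self : q β ≡ + 2
    pair-self = pair-unique β (+ 2) refl

    pair-neg-self : q (neg β) ≡ - + 2
    pair-neg-self = pair-unique (neg β) (- + 2) (begin
      - + 2 * ⟨ β , β ⟩          ≡⟨ ℤ.neg-distribˡ-* (+ 2) (⟨ β , β ⟩) ⟨
      - (+ 2 * ⟨ β , β ⟩)        ≡⟨ ℤ.neg-distribʳ-* (+ 2) (⟨ β , β ⟩) ⟩
      + 2 * - ⟨ β , β ⟩          ≡⟨ cong (λ t → + 2 * t) (trans (ip-sym (neg β) β) (ip-negʳ β β)) ⟨
      + 2 * ⟨ neg β , β ⟩        ∎)
      where open ≡-Reasoning

    reflect-neg-self : s (neg β) ≗ β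
    reflect-neg-self j = trans (cong (λ c → - β j - c * β j) pair-neg-self) (cancel (β j))
      where cancel : ∀ b → - b - - + 2 * b ≡ b
            cancel = solve-∀

    pair-nonneg⇒ip-nonneg : ∀ x → + 0 ≤ q x → + 0 ≤ ⟨ x , β ⟩
    pair-nonneg⇒ip-nonneg x 0≤q = ℤ.*-cancelˡ-≤-pos (+ 0) ⟨ x , β ⟩ (+ 2)
      (subst (+ 0 ≤_) (pair-exact x) (*-nonneg 0≤q (ℤ.<⇒≤ ip-self-pos)))

    -- If q x ≤ -2 then ⟨ x + β , x + β ⟩ ≤ ⟨ x , x ⟩ - ⟨ β , β ⟩ ≤ 0.
    pair-lower-bound : ∀ x → ⟨ x , x ⟩ ≤ ⟨ β , β ⟩ → ¬ x ≗ neg β → - + 1 ≤ q x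
    pair-lower-bound x x²≤β² x≉-β with q x ℤ.≤? - + 2
    ... | no  q≰-2 = ℤ.i<j⇒suc[i]≤j (ℤ.≰⇒> q≰-2)
    ... | yes q≤-2 = contradiction (λ j → inverseˡ-unique (x j) (β j) (x+β≗0 j)) x≉-β
      where
      open ≡-Reasoning
      x+β-nonpos : ⟨ x +ᵛ β , x +ᵛ β ⟩ ≤ + 0
      x+β-nonpos = ℤ.0≤i-j⇒j≤i (subst (+ 0 ≤_) (sym (begin
        + 0 - ⟨ x +ᵛ β , x +ᵛ β ⟩                            ≡⟨ cong (λ t → + 0 - t) (ip-+-self x β) ⟩
        + 0 - (⟨ x , x ⟩ + + 2 * ⟨ x , β ⟩ + ⟨ β , β ⟩)        ≡⟨ cong (λ t → + 0 - (⟨ x , x ⟩ + t + ⟨ β , β ⟩))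
                                                                    (pair-exact x) ⟨
        + 0 - (⟨ x , x ⟩ + q x * ⟨ β , β ⟩ + ⟨ β , β ⟩)        ≡⟨ regroup (⟨ x , x ⟩) (q x) (⟨ β , β ⟩) ⟩
        (⟨ β , β ⟩ - ⟨ x , x ⟩) + (- + 2 - q x) * ⟨ β , β ⟩    ∎))
        (ℤ.+-mono-≤ (ℤ.i≤j⇒0≤j-i x²≤β²) (*-nonneg (ℤ.i≤j⇒0≤j-i q≤-2) (ℤ.<⇒≤ ip-self-pos))))
        where regroup : ∀ a c b → + 0 - (a + c * b + b) ≡ (b - a) + (- + 2 - c) * b
              regroup = solve-∀
      x+β≗0 : x +ᵛ β ≗ (λ _ → + 0)
      x+β≗0 = ip-self-nonpos⇒≗0 (x +ᵛ β) x+β-nonpos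

  Reflectable-cong : ∀ {β β'} → β ≗ β' → Reflectable β → Reflectable β'
  Reflectable-cong {β} {β'} β≗β' β-reflectable = record
    { ip-self-pos = subst (+ 0 <_) norm≡ ip-self-pos
    ; ip-self-∣   = λ x → subst₂ ℤ∣._∣_ norm≡ (cong (λ t → + 2 * t) (ip-congʳ x β≗β')) (ip-self-∣ x)
    }
    where
    open Reflectable β-reflectable
    norm≡ : ⟨ β , β ⟩ ≡ ⟨ β' , β' ⟩
    norm≡ = trans (ip-congˡ β β≗β') (ip-congʳ β' β≗β')

  Reflectable-neg : ∀ {β} → Reflectable β → Reflectable (neg β)
  Reflectable-neg {β} β-reflectable = record
    { ip-self-pos = subst (+ 0 <_) (sym (ip-neg-neg β)) ip-self-pos
    ; ip-self-∣   = λ x → subst₂ ℤ∣._∣_ (sym (ip-neg-neg β)) (double-neg x) (ℤ∣.∣m⇒∣-m (ip-self-∣ x))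
    }
    where
    open Reflectable β-reflectable
    double-neg : ∀ x → - (+ 2 * ⟨ x , β ⟩) ≡ + 2 * ⟨ x , neg β ⟩
    double-neg x = trans (ℤ.neg-distribʳ-* (+ 2) (⟨ x , β ⟩)) (cong (λ t → + 2 * t) (sym (ip-negʳ x β)))

  Reflectable-reflect : ∀ {β γ} → Reflectable β → Reflectable γ → Reflectable (reflect D β γ)
  Reflectable-reflect {β} {γ} β-reflectable γ-reflectable = record
    { ip-self-pos = subst (+ 0 <_) (sym (ip-reflect-self γ)) ip-self-pos
    ; ip-self-∣   = λ x → subst₂ ℤ∣._∣_ (sym (ip-reflect-self γ))
                            (cong (λ t → + 2 * t) (sym (ip-reflect-adjoint x γ))) (ip-self-∣ (reflect D β x))
    }
    where
    open Reflection β-reflectable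
    open Reflectable γ-reflectable

  Reflectable-α : ∀ i → Reflectable (α i)
  Reflectable-α i = record { ip-self-pos = ip-α-self-pos i ; ip-self-∣ = divides }
    where
    divides : ∀ x → ⟨ α i , α i ⟩ ℤ∣.∣ + 2 * ⟨ x , α i ⟩
    divides x = subst₂ ℤ∣._∣_ (sym (ip-α-α i i)) (sym (begin
      + 2 * ⟨ x , α i ⟩                       ≡⟨ cong (λ t → + 2 * t) (trans (ip-sym x (α i)) (ip-αˡ i x)) ⟩
      + 2 * sum (λ j → B i j * x j)           ≡⟨ *-distribˡ-sum (+ 2) (λ j → B i j * x j) ⟩
      sum (λ j → + 2 * (B i j * x j))         ≡⟨ sum-cong-≗ (λ j → ℤ.*-assoc (+ 2) (B i j) (x j)) ⟨
      sum (λ j → + 2 * B i j * x j)           ∎))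
      (sum-∣ (λ j → ℤ∣.∣m⇒∣m*n {m = + 2 * B i j} (x j) (ℤ∣.∣ᵤ⇒∣ (integral i j))))
      where open ≡-Reasoning

  InΔ-reflect : ∀ j {β} → InΔ D β → InΔ D (reflect D (α j) β)
  InΔ-reflect j (u , i , u·αᵢ≗β) = j ∷ u , i , reflect-congʳ (α j) u·αᵢ≗β

  InΔ⇒Reflectable : ∀ {β} → InΔ D β → Reflectable β
  InΔ⇒Reflectable (u , i , u·αᵢ≗β) = Reflectable-cong u·αᵢ≗β (orbit u)
    where
    orbit : ∀ u → Reflectable (actFin D u (α i))
    orbit []      = Reflectable-α i
    orbit (j ∷ u) = Reflectable-reflect (Reflectable-α j) (orbit u)

  height : Lat ℓ → ℤ
  height = sum

  height-reflect : ∀ j x → height (reflect D (α j) x) ≡ height x - pair D x (α j)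
  height-reflect j x = begin
    sum (λ k → x k - q * α j k)              ≡⟨ sum-cong-≗ (λ k → as-combination (x k) q (α j k)) ⟩
    sum (λ k → + 1 * x k + - q * α j k)      ≡⟨ sum-linear (+ 1) (- q) x (α j) ⟩
    + 1 * sum x + - q * sum (α j)            ≡⟨ cong (λ t → + 1 * sum x + - q * t) sum-α ⟩
    + 1 * sum x + - q * + 1                  ≡⟨ simplify (sum x) q ⟩
    sum x - q                                ∎
    where
    open ≡-Reasoning
    q : ℤ
    q = pair D x (α j)
    as-combination : ∀ a c b → a - c * b ≡ + 1 * a + - c * b
    as-combination = solve-∀
    simplify : ∀ h c → + 1 * h + - c * + 1 ≡ h - c
    simplify = solve-∀
    sum-α : sum (α j) ≡ + 1
    sum-α = trans (sum-cong-≗ (λ k → sym (ℤ.*-identityʳ (α j k)))) (sum-δˡ j (λ _ → + 1))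

  module AffineAction {θ : Lat ℓ} (−θ-reflectable : Reflectable (neg θ)) where

    sAff-cong : ∀ x {p p'} → p ≈ᴬ p' → sAff D θ x p ≈ᴬ sAff D θ x p'
    sAff-cong (just j) = affReflect-cong (α j , + 0)
    sAff-cong nothing  = affReflect-cong (neg θ , + 1)

    act-cong : ∀ u {p p'} → p ≈ᴬ p' → act D θ u p ≈ᴬ act D θ u p'
    act-cong []      p≈p' = p≈p'
    act-cong (x ∷ u) p≈p' = sAff-cong x (act-cong u p≈p')

    sAff-involutive : ∀ x p → sAff D θ x (sAff D θ x p) ≈ᴬ p
    sAff-involutive (just j) = Reflection.affReflect-involutive (Reflectable-α j) (+ 0)
    sAff-involutive nothing  = Reflection.affReflect-involutive −θ-reflectable (+ 1)

    sAff-preserves-norm : ∀ x p → ⟨ proj₁ (sAff D θ x p) , proj₁ (sAff D θ x p) ⟩ ≡ ⟨ proj₁ p , proj₁ p ⟩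
    sAff-preserves-norm (just j) (γ , _) = Reflection.ip-reflect-self (Reflectable-α j) γ
    sAff-preserves-norm nothing  (γ , _) = Reflection.ip-reflect-self −θ-reflectable γ

    act-preserves-norm : ∀ u p → ⟨ proj₁ (act D θ u p) , proj₁ (act D θ u p) ⟩ ≡ ⟨ proj₁ p , proj₁ p ⟩
    act-preserves-norm []      p = refl
    act-preserves-norm (x ∷ u) p = trans (sAff-preserves-norm x (act D θ u p)) (act-preserves-norm u p)

    act-++ : ∀ u v p → act D θ (u ++ v) p ≡ act D θ u (act D θ v p)
    act-++ u v p = List.foldr-++ (sAff D θ) p u v

    act-inv : ∀ u p → act D θ u (act D θ (inv D u) p) ≈ᴬ p
    act-inv []      p = ≈ᴬ-refl
    act-inv (x ∷ u) p = ≈ᴬ-trans (sAff-cong x (act-cong u unfold)) (≈ᴬ-trans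
                          (sAff-cong x (act-inv u (sAff D θ x p))) (sAff-involutive x p))
      where
      unfold : act D θ (inv D (x ∷ u)) p ≈ᴬ act D θ (inv D u) (sAff D θ x p)
      unfold = ≡⇒≈ᴬ (trans (cong (λ v → act D θ v p) (List.unfold-reverse x u))
                           (act-++ (inv D u) (x ∷ []) p))

    EqW-inv : ∀ u w → EqW D θ u w → EqW D θ (inv D u) (inv D w)
    EqW-inv u w u≈w p = ≈ᴬ-sym (≈ᴬ-trans (act-cong (inv D w) (≈ᴬ-trans (≈ᴬ-sym (act-inv u p)) (u≈w y)))
                                (subst (λ v → act D θ (inv D w) (act D θ v y) ≈ᴬ y)
                                       (List.reverse-involutive w) (act-inv (inv D w) y)))
      where
      y : Aff D
      y = act D θ (inv D u) p

    IsLength-inv : ∀ {w k} → IsLength D θ w k → IsLength D θ (inv D w) k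
    IsLength-inv {w} {k} ((u , length-u , u≈w) , minimal) =
      (inv D u , trans (List.length-reverse u) length-u , EqW-inv u w u≈w) ,
      λ v v≈w⁻¹ → subst (k ℕ.≤_) (List.length-reverse v)
        (minimal (inv D v) (subst (EqW D θ (inv D v)) (List.reverse-involutive w) (EqW-inv v (inv D w) v≈w⁻¹)))

  Dominant? : ∀ β → Dec (Dominant β)
  Dominant? β = all? (λ i → + 0 ℤ.≤? ⟨ α i , β ⟩)

  raise-non-dominant : ∀ {β} → InΔ D β → ¬ Dominant β →
                       ∃ λ β' → InΔ D β' × ⟨ β' , β' ⟩ ≡ ⟨ β , β ⟩ × height β + + 1 ≤ height β'
  raise-non-dominant {β} β∈Δ β-not-dominant =
    reflect D (α j) β , InΔ-reflect j β∈Δ , ip-reflect-self β , raised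
    where
    j-witness : ∃ λ j → ¬ (+ 0 ≤ ⟨ α j , β ⟩)
    j-witness = ¬∀⟶∃¬ ℓ _ (λ i → + 0 ℤ.≤? ⟨ α i , β ⟩) β-not-dominant
    j : Fin ℓ
    j = proj₁ j-witness
    open Reflection (Reflectable-α j)
    pair<0 : pair D β (α j) < + 0
    pair<0 = ℤ.≰⇒> (λ 0≤pair → proj₂ j-witness (subst (+ 0 ≤_) (ip-sym β (α j))
                                                  (pair-nonneg⇒ip-nonneg β 0≤pair)))
    raised : height β + + 1 ≤ height (reflect D (α j) β)
    raised = subst (height β + + 1 ≤_) (sym (height-reflect j β))
                   (ℤ.+-monoʳ-≤ (height β) (i<0⇒+1≤-i pair<0))

  Reflectable⇒≉neg : ∀ {β} → Reflectable β → ¬ β ≗ neg β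
  Reflectable⇒≉neg {β} β-reflectable β≗-β = ℤ.<-asym ip-self-pos (begin-strict
    ⟨ β , β ⟩       ≡⟨ ip-congʳ β β≗-β ⟩
    ⟨ β , neg β ⟩   ≡⟨ ip-negʳ β β ⟩
    - ⟨ β , β ⟩     <⟨ ℤ.neg-mono-< ip-self-pos ⟩
    + 0             ∎)
    where
    open Reflectable β-reflectable
    open ℤ.≤-Reasoning

  IsPosAff⇒nonneg : ∀ {p} → IsPosAff D p → + 0 ≤ proj₂ p
  IsPosAff⇒nonneg (inj₁ 0<n)       = ℤ.<⇒≤ 0<n
  IsPosAff⇒nonneg (inj₂ (n≡0 , _)) = ℤ.≤-reflexive (sym n≡0)

  module HighestRoot {θ : Lat ℓ} (θ-highest : IsHighestRoot D θ) where

    θ∈Δ : InΔ D θ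
    θ∈Δ = proj₁ θ-highest

    below-θ : ∀ {β} → InΔ D β → ∀ j → β j ≤ θ j
    below-θ {β} = proj₂ θ-highest β

    θ-dominant : Dominant θ
    θ-dominant j = subst (+ 0 ≤_) (ip-sym θ (α j)) (pair-nonneg⇒ip-nonneg θ 0≤pair)
      where
      open Reflection (Reflectable-α j)
      coordinate : θ j - reflect D (α j) θ j ≡ pair D θ (α j)
      coordinate = trans (cong (λ d → θ j - (θ j - pair D θ (α j) * d)) (δ-diag j))
                         (cancel (θ j) (pair D θ (α j)))
        where cancel : ∀ a c → a - (a - c * + 1) ≡ c
              cancel = solve-∀
      0≤pair : + 0 ≤ pair D θ (α j)
      0≤pair = subst (+ 0 ≤_) coordinate (ℤ.i≤j⇒0≤j-i (below-θ (InΔ-reflect j θ∈Δ) j))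

    dominant-root-≤-θ : ∀ {β} → InΔ D β → Dominant β → ⟨ β , β ⟩ ≤ ⟨ θ , θ ⟩
    dominant-root-≤-θ {β} β∈Δ β-dominant = ℤ.0≤i-j⇒j≤i
      (subst (+ 0 ≤_) (sym (ip-difference-of-squares θ β))
             (ip-nonneg-dominant (λ j → ℤ.i≤j⇒0≤j-i (below-θ β∈Δ j)) (Dominant-+ θ-dominant β-dominant)))

    dominant-conjugate : ∀ n {β} → InΔ D β → height θ ≤ height β + + n →
                         ∃ λ β' → InΔ D β' × ⟨ β' , β' ⟩ ≡ ⟨ β , β ⟩ × Dominant β'
    dominant-conjugate n {β} β∈Δ θ≤β+n with Dominant? β
    ... | yes β-dominant = β , β∈Δ , refl , β-dominant
    ... | no  β-not-dominant = climb n θ≤β+n (raise-non-dominant β∈Δ β-not-dominant)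
      where
      climb : ∀ n → height θ ≤ height β + + n →
              (∃ λ β' → InΔ D β' × ⟨ β' , β' ⟩ ≡ ⟨ β , β ⟩ × height β + + 1 ≤ height β') →
              ∃ λ β' → InΔ D β' × ⟨ β' , β' ⟩ ≡ ⟨ β , β ⟩ × Dominant β'
      climb zero θ≤β+0 (β' , β'∈Δ , _ , raised) = contradiction raised (ℤ.<⇒≱ (begin-strict
        height β'        ≤⟨ sum-mono-≤ (below-θ β'∈Δ) ⟩
        height θ         ≤⟨ θ≤β+0 ⟩
        height β + + 0   <⟨ ℤ.+-monoʳ-< (height β) (+<+ (ℕ.s≤s ℕ.z≤n)) ⟩
        height β + + 1   ∎))
        where open ℤ.≤-Reasoning
      climb (suc m) θ≤β+n (β' , β'∈Δ , β'²≡β² , raised)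
        with dominant-conjugate m β'∈Δ (begin
          height θ                  ≤⟨ θ≤β+n ⟩
          height β + (+ 1 + + m)    ≡⟨ ℤ.+-assoc (height β) (+ 1) (+ m) ⟨
          height β + + 1 + + m      ≤⟨ ℤ.+-monoˡ-≤ (+ m) raised ⟩
          height β' + + m           ∎)
        where open ℤ.≤-Reasoning
      ... | β'' , β''∈Δ , β''²≡β'² , β''-dominant = β'' , β''∈Δ , trans β''²≡β'² β'²≡β² , β''-dominant

    height-gap : ∀ {β} → InΔ D β → height θ ≤ height β + + ℤ.∣ height θ - height β ∣
    height-gap {β} β∈Δ = ℤ.≤-reflexive (begin
      height θ                                   ≡⟨ restore (height θ) (height β) ⟩
      height β + (height θ - height β)           ≡⟨ cong (λ t → height β + t) (ℤ.0≤i⇒+∣i∣≡i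
                                                      (ℤ.i≤j⇒0≤j-i (sum-mono-≤ (below-θ β∈Δ)))) ⟨
      height β + + ℤ.∣ height θ - height β ∣     ∎)
      where
      open ≡-Reasoning
      restore : ∀ t b → t ≡ b + (t - b)
      restore = solve-∀

    θ-longest : ∀ {β} → InΔ D β → ⟨ β , β ⟩ ≤ ⟨ θ , θ ⟩
    θ-longest {β} β∈Δ with dominant-conjugate ℤ.∣ height θ - height β ∣ β∈Δ (height-gap β∈Δ)
    ... | β' , β'∈Δ , β'²≡β² , β'-dominant = subst (_≤ ⟨ θ , θ ⟩) β'²≡β² (dominant-root-≤-θ β'∈Δ β'-dominant)

    −θ-reflectable : Reflectable (neg θ)
    −θ-reflectable = Reflectable-neg (InΔ⇒Reflectable θ∈Δ)

    open AffineAction −θ-reflectable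
    open Reflection −θ-reflectable using (pair-self; pair-neg-self; reflect-neg-self; pair-lower-bound)

    -- The ι-coefficient, lowered by one at the finite part -θ; it grows by at most one per reflection.
    potential : Aff D → ℤ
    potential (γ , n) with all? (λ j → γ j ℤ.≟ neg θ j)
    ... | yes _ = n - + 1
    ... | no  _ = n

    potential-≤ : ∀ p → potential p ≤ proj₂ p
    potential-≤ (γ , n) with all? (λ j → γ j ℤ.≟ neg θ j)
    ... | yes _ = ℤ.i-j≤i n (+ 1)
    ... | no  _ = ℤ.≤-refl

    ≤-potential+1 : ∀ p → proj₂ p ≤ potential p + + 1
    ≤-potential+1 (γ , n) with all? (λ j → γ j ℤ.≟ neg θ j)
    ... | yes _ = ℤ.≤-reflexive (restore n)
      where restore : ∀ n → n ≡ n - + 1 + + 1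
            restore = solve-∀
    ... | no  _ = ℤ.i≤i+j n (+ 1)

    potential-at-−θ : ∀ {γ} n → γ ≗ neg θ → potential (γ , n) ≡ n - + 1
    potential-at-−θ {γ} n γ≗−θ with all? (λ j → γ j ℤ.≟ neg θ j)
    ... | yes _    = refl
    ... | no γ≉−θ = contradiction γ≗−θ γ≉−θ

    potential-off-−θ : ∀ {γ} n → ¬ γ ≗ neg θ → potential (γ , n) ≡ n
    potential-off-−θ {γ} n γ≉−θ with all? (λ j → γ j ℤ.≟ neg θ j)
    ... | yes γ≗−θ = contradiction γ≗−θ γ≉−θ
    ... | no  _    = refl

    potential-s₀-at-θ : ∀ {γ} n → γ ≗ θ → potential (sAff D θ nothing (γ , n)) ≡ potential (γ , n) + + 1
    potential-s₀-at-θ {γ} n γ≗θ = begin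
      potential (sAff D θ nothing (γ , n))   ≡⟨ potential-at-−θ (n - q * + 1) s₀γ≗−θ ⟩
      n - q * + 1 - + 1                      ≡⟨ cong (λ c → n - c * + 1 - + 1) q≡-2 ⟩
      n - - + 2 * + 1 - + 1                  ≡⟨ simplify n ⟩
      n + + 1                                ≡⟨ cong (_+ + 1) (potential-off-−θ n γ≉−θ) ⟨
      potential (γ , n) + + 1                ∎
      where
      open ≡-Reasoning
      q : ℤ
      q = pair D γ (neg θ)
      γ≗−−θ : γ ≗ neg (neg θ)
      γ≗−−θ j = trans (γ≗θ j) (sym (ℤ.neg-involutive (θ j)))
      q≡-2 : q ≡ - + 2
      q≡-2 = trans (pair-congˡ (neg θ) γ≗−−θ) pair-neg-self
      s₀γ≗−θ : reflect D (neg θ) γ ≗ neg θ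
      s₀γ≗−θ j = trans (reflect-congʳ (neg θ) γ≗−−θ j) (reflect-neg-self j)
      γ≉−θ : ¬ γ ≗ neg θ
      γ≉−θ γ≗−θ = Reflectable⇒≉neg (InΔ⇒Reflectable θ∈Δ) (λ j → trans (sym (γ≗θ j)) (γ≗−θ j))
      simplify : ∀ n → n - - + 2 * + 1 - + 1 ≡ n + + 1
      simplify = solve-∀

    potential-s₀-at-−θ : ∀ {γ} n → γ ≗ neg θ → potential (sAff D θ nothing (γ , n)) ≤ potential (γ , n) + + 1
    potential-s₀-at-−θ {γ} n γ≗−θ = begin
      potential (sAff D θ nothing (γ , n))   ≤⟨ potential-≤ (sAff D θ nothing (γ , n)) ⟩
      n - q * + 1                            ≡⟨ cong (λ c → n - c * + 1) q≡2 ⟩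
      n - + 2 * + 1                          ≡⟨ regroup n ⟩
      n - + 1 + + 1 - + 2                    ≤⟨ ℤ.i-j≤i (n - + 1 + + 1) (+ 2) ⟩
      n - + 1 + + 1                          ≡⟨ cong (_+ + 1) (potential-at-−θ n γ≗−θ) ⟨
      potential (γ , n) + + 1                ∎
      where
      open ℤ.≤-Reasoning
      q : ℤ
      q = pair D γ (neg θ)
      q≡2 : q ≡ + 2
      q≡2 = trans (pair-congˡ (neg θ) γ≗−θ) pair-self
      regroup : ∀ n → n - + 2 * + 1 ≡ n - + 1 + + 1 - + 2
      regroup = solve-∀

    potential-s₀-elsewhere : ∀ {γ} n → ⟨ γ , γ ⟩ ≤ ⟨ θ , θ ⟩ → ¬ γ ≗ θ → ¬ γ ≗ neg θ →
                             potential (sAff D θ nothing (γ , n)) ≤ potential (γ , n) + + 1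
    potential-s₀-elsewhere {γ} n γ²≤θ² γ≉θ γ≉−θ = begin
      potential (sAff D θ nothing (γ , n))   ≤⟨ potential-≤ (sAff D θ nothing (γ , n)) ⟩
      n - q * + 1                            ≡⟨ cong (λ c → n - c) (ℤ.*-identityʳ q) ⟩
      n - q                                  ≤⟨ ℤ.+-monoʳ-≤ n (ℤ.neg-mono-≤ -1≤q) ⟩
      n + + 1                                ≡⟨ cong (_+ + 1) (potential-off-−θ n γ≉−θ) ⟨
      potential (γ , n) + + 1                ∎
      where
      open ℤ.≤-Reasoning
      q : ℤ
      q = pair D γ (neg θ)
      -1≤q : - + 1 ≤ q
      -1≤q = pair-lower-bound γ (subst (⟨ γ , γ ⟩ ≤_) (sym (ip-neg-neg θ)) γ²≤θ²)
               (λ γ≗−−θ → γ≉θ (λ j → trans (γ≗−−θ j) (ℤ.neg-involutive (θ j))))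

    potential-s₀ : ∀ {γ} n → ⟨ γ , γ ⟩ ≤ ⟨ θ , θ ⟩ → Dec (γ ≗ θ) → Dec (γ ≗ neg θ) →
                   potential (sAff D θ nothing (γ , n)) ≤ potential (γ , n) + + 1
    potential-s₀ n _     (yes γ≗θ) _          = ℤ.≤-reflexive (potential-s₀-at-θ n γ≗θ)
    potential-s₀ n _     (no _)    (yes γ≗−θ) = potential-s₀-at-−θ n γ≗−θ
    potential-s₀ n γ²≤θ² (no γ≉θ)  (no γ≉−θ)  = potential-s₀-elsewhere n γ²≤θ² γ≉θ γ≉−θ

    potential-sAff : ∀ x p → ⟨ proj₁ p , proj₁ p ⟩ ≤ ⟨ θ , θ ⟩ →
                     potential (sAff D θ x p) ≤ potential p + + 1
    potential-sAff (just j) p@(γ , n) _ = begin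
      potential (sAff D θ (just j) p)     ≤⟨ potential-≤ (sAff D θ (just j) p) ⟩
      n - pair D γ (α j) * + 0            ≡⟨ drop-zero n (pair D γ (α j)) ⟩
      n                                   ≤⟨ ≤-potential+1 p ⟩
      potential p + + 1                   ∎
      where
      open ℤ.≤-Reasoning
      drop-zero : ∀ n c → n - c * + 0 ≡ n
      drop-zero = solve-∀
    potential-sAff nothing (γ , n) γ²≤θ² =
      potential-s₀ n γ²≤θ² (all? (λ j → γ j ℤ.≟ θ j)) (all? (λ j → γ j ℤ.≟ neg θ j))

    potential-act : ∀ u p → ⟨ proj₁ p , proj₁ p ⟩ ≤ ⟨ θ , θ ⟩ →
                    potential (act D θ u p) ≤ potential p + + length u
    potential-act []      p _     = ℤ.≤-reflexive (sym (ℤ.+-identityʳ (potential p)))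
    potential-act (x ∷ u) p γ²≤θ² = begin
      potential (sAff D θ x (act D θ u p))
        ≤⟨ potential-sAff x (act D θ u p) (subst (_≤ ⟨ θ , θ ⟩) (sym (act-preserves-norm u p)) γ²≤θ²) ⟩
      potential (act D θ u p) + + 1      ≤⟨ ℤ.+-monoˡ-≤ (+ 1) (potential-act u p γ²≤θ²) ⟩
      potential p + + length u + + 1     ≡⟨ ℤ.+-assoc (potential p) (+ length u) (+ 1) ⟩
      potential p + (+ length u + + 1)   ≡⟨ cong (λ t → potential p + t) (ℤ.+-comm (+ length u) (+ 1)) ⟩
      potential p + + suc (length u)     ∎
      where open ℤ.≤-Reasoning

    ι-coefficient-≤ : ∀ u i → proj₂ (act D θ u (α i , + 0)) ≤ + suc (length u)
    ι-coefficient-≤ u i = begin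
      proj₂ (act D θ u (α i , + 0))             ≤⟨ ≤-potential+1 (act D θ u (α i , + 0)) ⟩
      potential (act D θ u (α i , + 0)) + + 1
        ≤⟨ ℤ.+-monoˡ-≤ (+ 1) (potential-act u (α i , + 0) (θ-longest ([] , i , λ _ → refl))) ⟩
      potential (α i , + 0) + + length u + + 1
        ≤⟨ ℤ.+-monoˡ-≤ (+ 1) (ℤ.+-monoˡ-≤ (+ length u) (potential-≤ (α i , + 0))) ⟩
      + (length u) + + 1                        ≡⟨ ℤ.+-comm (+ length u) (+ 1) ⟩
      + suc (length u)                          ∎
      where open ℤ.≤-Reasoning

lemma2p9 : ∀ {ℓ : ℕ} (D : CartanDatum ℓ) (θ : Lat ℓ) → IsHighestRoot D θ
    → (w : Word D) → InWθ D θ w → (k : ℕ) → IsLength D θ w k → (i : Fin ℓ)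
    → (+ 0 ≤ kappa D θ w i × kappa D θ w i ≤ + suc k) × IsLength D θ (inv D w) k
lemma2p9 D θ θ-highest w w∈Wθ k w-length@((u , length-u≡k , u≈w) , _) i =
  (IsPosAff⇒nonneg D (w∈Wθ i) , κ≤k+1) , IsLength-inv {w} w-length
  where
  open HighestRoot D θ-highest
  open AffineAction D −θ-reflectable
  κ≤k+1 : kappa D θ w i ≤ + suc k
  κ≤k+1 = subst₂ (λ κ m → κ ≤ + suc m)
    (proj₂ (EqW-inv u w u≈w (α D i , + 0)))
    (trans (List.length-reverse u) length-u≡k)
    (ι-coefficient-≤ (inv D u) i)
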